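{- Let $I=(G,v_0,c,d,Q)$ be an MWCARP instance with an optimal solution $(\mathcal W^*,s^*)$, let $(\mathcal W,s)$ with $\mathcal W=(w_1,\dots,w_\ell)$ be a feasible splitting of some closed walk $T$ containing all of $R_d$, and let $\mathcal W^2=\{(w_{2i-1},w_{2i}) : i\in\{1,\dots,\lfloor \ell/2\rfloor\}\}$ be its consecutive pairing. Then there is an injective map $\phi\colon\mathcal W^2\to\mathcal W^*$ such that for every pair $(w_i,w_{i+1})\in\mathcal W^2$, $(s(w_i)\cup s(w_{i+1}))\cap s^*(\phi(w_i,w_{i+1}))\neq\emptyset$.
   Context: Mixed graph $G=(V,E,A)$ (undirected edges $E$, arcs $A\subseteq V\times V$), windy travel costs $c\colon V\times V\to\mathbb N\cup\{0,\infty\}$. Walks: sequences of pairs $(u,v)$ with $(u,v)\in A$ or $\{u,v\}\in E$ and matching consecutive head/tail; closed if returning to the start; cost is the sum of costs. MWCARP: given $G$, depot $v_0$, $c$, demands $d\colon E\cup A\to\mathbb N\cup\{0\}$, capacity $Q$, find a set $\mathcal W$ of closed walks each through $v_0$ and a serving function $s\colon\mathcal W\to 2^{E\cup A}$ with $\sum_{e\in s(w)}d(e)\le Q$ for every $w$ and each positive-demand element served by exactly one walk, minimizing total cost. $R_d=\{a\in E\cup A: d(a)>0\}$. A segment of a walk $(a_1,\dots,a_m)$ is a consecutive subsequence; segments $(a_i,\dots,a_j)$ and $(a_{i'},\dots,a_{j'})$ are non-overlapping if $j<i'$ or $j'<i$. For a closed walk $T$ containing all of $R_d$, a feasible splitting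 of $T$ is a pair $(\mathcal W,s)$ where $\mathcal W=(w_1,\dots,w_\ell)$ is a tuple of segments of $T$ and $s\colon\mathcal W\to 2^{R_d}$, such that: (i) the $w_i$ are mutually non-overlapping; (ii) concatenating $w_1,\dots,w_\ell$ in order gives a subsequence of $T$; (iii) each $w_i$ begins and ends with an element of $s(w_i)$; (iv) $\{s(w_i)\}$ is a partition of $R_d$; (v) $\sum_{e\in s(w_i)}d(e)\le Q$ for all $i$, and for $i<\ell$, $\sum_{e\in s(w_i)}d(e)+d(a)>Q$ where $a$ is the first element served by $w_{i+1}$. -}

module Defs where

open import Data.Nat using (ℕ; zero; suc; _+_; _≤_; _<_)
open import Data.Fin using (Fin)
open import Data.List using (List; []; _∷_; map; _++_; concat; take; drop; length; allFin)
open import Data.Nat.ListAction using (sum)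
open import Data.List.Relation.Unary.Linked using (Linked)
open import Data.List.Relation.Unary.Any using (Any)
open import Data.List.Relation.Binary.Sublist.Propositional using (_⊆_)
open import Data.Bool using (Bool; true; false; if_then_else_)
open import Data.Maybe using (Maybe; just; nothing)
open import Data.Product using (Σ; _×_; _,_)
open import Data.Sum using (_⊎_; inj₁; inj₂)
open import Data.Unit using (⊤)
open import Data.Empty using (⊥)
open import Function.Definitions using (Injective)
open import Relation.Binary.PropositionalEquality using (_≡_; _≢_)

data ℕ∞ : Set where
  fin : ℕ → ℕ∞
  ∞   : ℕ∞

infixl 6 _+∞_
_+∞_ : ℕ∞ → ℕ∞ → ℕ∞
fin m +∞ fin n = fin (m + n)
fin _ +∞ ∞     = ∞
∞     +∞ _     = ∞

infix 4 _≤∞_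
data _≤∞_ : ℕ∞ → ℕ∞ → Set where
  fin≤fin : ∀ {m n} → m ≤ n → fin m ≤∞ fin n
  _≤∞∞    : ∀ x → x ≤∞ ∞

-- Mixed graphs: vertices Fin nV, undirected edges indexed by Fin nE
-- (with their two end vertices), arcs indexed by Fin nA (tail, head).

record MixedGraph : Set where
  field
    nV nE nA : ℕ
    edgeEnds : Fin nE → Fin nV × Fin nV
    arcEnds  : Fin nA → Fin nV × Fin nV

module _ (G : MixedGraph) where
  open MixedGraph G

  Vertex : Set
  Vertex = Fin nV

  Link : Set
  Link = Fin nE ⊎ Fin nA

  allLinks : List Link
  allLinks = map inj₁ (allFin nE) ++ map inj₂ (allFin nA)

  -- a walk element: a pair (u,v) with {u,v} ∈ E (either direction)
  -- or (u,v) ∈ A, recorded together with the element it traverses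
  data Step : Set where
    edgeFwd : Fin nE → Step
    edgeBwd : Fin nE → Step
    arcStep : Fin nA → Step

  tailV : Step → Vertex
  tailV (edgeFwd e) = Data.Product.proj₁ (edgeEnds e)
  tailV (edgeBwd e) = Data.Product.proj₂ (edgeEnds e)
  tailV (arcStep a) = Data.Product.proj₁ (arcEnds a)

  headV : Step → Vertex
  headV (edgeFwd e) = Data.Product.proj₂ (edgeEnds e)
  headV (edgeBwd e) = Data.Product.proj₁ (edgeEnds e)
  headV (arcStep a) = Data.Product.proj₂ (arcEnds a)

  linkOf : Step → Link
  linkOf (edgeFwd e) = inj₁ e
  linkOf (edgeBwd e) = inj₁ e
  linkOf (arcStep a) = inj₂ a

  Walk : Set
  Walk = List Step

  lastStep : Step → List Step → Step
  lastStep x []      = x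
  lastStep x (y ∷ w) = lastStep y w

  IsWalk : Walk → Set
  IsWalk w = Linked (λ x y → headV x ≡ tailV y) w

  ReturnsToStart : Walk → Set
  ReturnsToStart []      = ⊤
  ReturnsToStart (x ∷ w) = headV (lastStep x w) ≡ tailV x

  IsClosedWalk : Walk → Set
  IsClosedWalk w = IsWalk w × ReturnsToStart w

  Through : Vertex → Walk → Set
  Through v w = Any (λ x → tailV x ≡ v) w

  cost : (Vertex → Vertex → ℕ∞) → Walk → ℕ∞
  cost c []      = fin 0
  cost c (x ∷ w) = c (tailV x) (headV x) +∞ cost c w

  Subset : Set
  Subset = Link → Bool

  load : (Link → ℕ) → Subset → ℕ
  load d S = sum (map (λ l → if S l then d l else 0) allLinks)

  BeginsIn : Subset → Walk → Set
  BeginsIn S []      = ⊥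
  BeginsIn S (x ∷ w) = S (linkOf x) ≡ true

  EndsIn : Subset → Walk → Set
  EndsIn S []      = ⊥
  EndsIn S (x ∷ w) = S (linkOf (lastStep x w)) ≡ true

  firstServed : Subset → Walk → Maybe Link
  firstServed S []      = nothing
  firstServed S (x ∷ w) = if S (linkOf x) then just (linkOf x) else firstServed S w

record Instance : Set where
  field
    G  : MixedGraph
    v₀ : Vertex G
    c  : Vertex G → Vertex G → ℕ∞
    d  : Link G → ℕ
    Q  : ℕ

ExactlyOne : ∀ {k} → (Fin k → Set) → Set
ExactlyOne {k} P = Σ (Fin k) λ i → P i × (∀ j → P j → j ≡ i)

module _ (I : Instance) where
  open Instance I

  Required : Link G → Set
  Required l = 0 < d l

  -- a candidate solution: a family of k walks (a set: required injective
  -- below) with a serving function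
  record Solution : Set where
    field
      k     : ℕ
      walk  : Fin k → Walk G
      serve : Fin k → Subset G

  totalCost : Solution → ℕ∞
  totalCost W = go (allFin (Solution.k W))
    where
    go : List (Fin (Solution.k W)) → ℕ∞
    go []      = fin 0
    go (i ∷ is) = cost G c (Solution.walk W i) +∞ go is

  record Feasible (W : Solution) : Set where
    open Solution W
    field
      distinct : Injective _≡_ _≡_ walk
      closed   : ∀ i → IsClosedWalk G (walk i)
      depot    : ∀ i → Through G v₀ (walk i)
      capacity : ∀ i → load G d (serve i) ≤ Q
      servedOnce : ∀ l → Required l → ExactlyOne (λ i → serve i l ≡ true)

  Optimal : Solution → Set
  Optimal W = Feasible W × (∀ W' → Feasible W' → totalCost W ≤∞ totalCost W')

  ContainsRequired : Walk G → Set
  ContainsRequired T = ∀ l → Required l → Any (λ x → linkOf G x ≡ l) T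

  -- a tuple of ℓ segments of T, segment i being positions
  -- begin i .. end i (0-based, inclusive) of T, with a serving function
  record Splitting : Set where
    field
      ℓ     : ℕ
      begin : Fin ℓ → ℕ
      end   : Fin ℓ → ℕ
      serve : Fin ℓ → Subset G

  segmentOf : Walk G → ℕ → ℕ → Walk G
  segmentOf T b e = drop b (take (suc e) T)

  record FeasibleSplitting (T : Walk G) (S : Splitting) : Set where
    open Splitting S
    seg : Fin ℓ → Walk G
    seg i = segmentOf T (begin i) (end i)
    field
      isSegment   : ∀ i → begin i ≤ end i × end i < length T
      nonOverlap  : ∀ i j → i ≢ j → end i < begin j ⊎ end j < begin i
      ordered     : concat (map seg (allFin ℓ)) ⊆ T
      begins      : ∀ i → BeginsIn G (serve i) (seg i)
      ends        : ∀ i → EndsIn G (serve i) (seg i)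
      servesReq   : ∀ i l → serve i l ≡ true → Required l
      partition   : ∀ l → Required l → ExactlyOne (λ i → serve i l ≡ true)
      capacity    : ∀ i → load G d (serve i) ≤ Q
      maximal     : ∀ i j a → Data.Fin.toℕ j ≡ suc (Data.Fin.toℕ i) →
                    firstServed G (serve j) (seg j) ≡ just a →
                    Q < load G d (serve i) + d a

module Submission where

-- The proof is Hall's marriage theorem.  Join pair p = (w_{2p}, w_{2p+1}) to walk j of the
-- solution when s(w_{2p}) ∪ s(w_{2p+1}) meets s*(j).  By condition (v) of a feasible
-- splitting, the demand of w_{2p} plus that of the first element of w_{2p+1} exceeds Q, so
-- every pair serves more than Q.  Different pairs serve disjoint sets (the s(w_i) partition
-- R_d), and every element they serve is served by an adjacent walk (the s*(j) cover R_d).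
-- Hence a set X of pairs serves more than ∣X∣·Q, all of it carried by the walks of its
-- neighbourhood N X, which carry at most ∣N X∣·Q: thus ∣X∣ ≤ ∣N X∣, Hall's condition.

open import Defs hiding (Subset)
open import Data.Nat using (ℕ; zero; suc; _+_; _*_; _/_; _≤_; _<_; z≤n; _≤?_; _<?_)
open import Data.Nat.Properties
  using ( ≤-reflexive; ≤-trans; ≤-<-trans; <-trans; <⇒≱; ≰⇒>; ≤-pred; n<1+n; n≤1+n; 1+n≢n
        ; m≤m+n; m≤n+m; +-suc; +-comm; +-identityʳ; +-cancelˡ-≤; +-mono-≤; +-monoˡ-≤; +-monoʳ-≤
        ; *-suc; *-comm; *-monoʳ-≤; *-cancelˡ-≡; *-cancelʳ-≤; suc-injective; even≢odd
        ; +-commutativeSemigroup; module ≤-Reasoning)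
open import Data.Nat.DivMod using (m/n*n≤m)
open import Data.Nat.ListAction using (sum)
open import Data.Fin using (Fin; zero; suc; _≟_; toℕ; fromℕ<)
open import Data.Fin.Properties using (any?; toℕ-fromℕ<; toℕ-injective; toℕ<n) renaming (suc-injective to Fin-suc-injective)
open import Data.Fin.Subset
  using (Subset; inside; outside; _∈_; _∉_; _⊆_; _∪_; _∩_; _─_; _-_; ⁅_⁆; ⊤; ∣_∣; Nonempty; Empty)
open import Data.Fin.Subset.Properties
  using ( _∈?_; nonempty?; anySubset?; _⊆?_; Empty-unique; ∣⊥∣≡0; ∣⊤∣≡n; ∈⊤; ∣⁅x⁆∣≡1; x∈⁅x⁆; x∈⁅y⁆⇒x≡y
        ; p⊆q⇒∣p∣≤∣q∣; x∈p⇒∣p-x∣<∣p∣; p∩q≢∅⇒∣p─q∣<∣p∣; p─q⊆p; p∩q⊆q; x∈p∧x∉q⇒x∈p─q; x∈p∧x≢y⇒x∈p-y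
        ; x∈p∩q⁺; x∈p∩q⁻; x∈p∪q⁺; x∈p∪q⁻; ⊆-trans; ∩-identityʳ)
open import Data.Vec using ([]; _∷_; here; there; tabulate)
open import Data.Vec.Properties using ([]=⇒lookup; lookup⇒[]=; lookup∘tabulate)
open import Data.List using (List; []; _∷_; map)
open import Data.List.Properties using (map-cong)
open import Data.List.Membership.Propositional using (lose) renaming (_∈_ to _∈ˡ_)
open import Data.List.Membership.Propositional.Properties using (∈-map⁺; ∈-++⁺ˡ; ∈-++⁺ʳ; ∈-allFin)
open import Data.List.Relation.Unary.Any as Any using (Any; here; there)
open import Data.Bool using (Bool; true; false; if_then_else_; _∨_)
import Data.Bool as Bool
open import Data.Maybe using (just)
open import Data.Product using (Σ; ∃; _×_; _,_; proj₁; proj₂)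
open import Data.Sum using (_⊎_; inj₁; inj₂)
open import Data.Empty using (⊥-elim)
open import Function using (_∘_)
open import Function.Definitions using (Injective)
open import Relation.Binary.Definitions using (Decidable)
open import Relation.Nullary using (Dec; yes; no; ¬_; does; contradiction)
open import Relation.Nullary.Decidable using (_×-dec_; dec-true)
open import Relation.Binary.PropositionalEquality
  using (_≡_; _≢_; refl; sym; trans; cong; cong₂; subst; subst₂; module ≡-Reasoning)
open import Algebra.Properties.CommutativeSemigroup +-commutativeSemigroup using (interchange)

∣p∪q∣+∣p∩q∣≡∣p∣+∣q∣ : ∀ {n} (p q : Subset n) → ∣ p ∪ q ∣ + ∣ p ∩ q ∣ ≡ ∣ p ∣ + ∣ q ∣
∣p∪q∣+∣p∩q∣≡∣p∣+∣q∣ []            []            = refl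
∣p∪q∣+∣p∩q∣≡∣p∣+∣q∣ (outside ∷ p) (outside ∷ q) = ∣p∪q∣+∣p∩q∣≡∣p∣+∣q∣ p q
∣p∪q∣+∣p∩q∣≡∣p∣+∣q∣ (inside ∷ p)  (outside ∷ q) = cong suc (∣p∪q∣+∣p∩q∣≡∣p∣+∣q∣ p q)
∣p∪q∣+∣p∩q∣≡∣p∣+∣q∣ (outside ∷ p) (inside ∷ q)  =
  trans (cong suc (∣p∪q∣+∣p∩q∣≡∣p∣+∣q∣ p q)) (sym (+-suc ∣ p ∣ ∣ q ∣))
∣p∪q∣+∣p∩q∣≡∣p∣+∣q∣ (inside ∷ p)  (inside ∷ q)  = cong suc (begin
  ∣ p ∪ q ∣ + suc ∣ p ∩ q ∣  ≡⟨ +-suc ∣ p ∪ q ∣ ∣ p ∩ q ∣ ⟩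
  suc (∣ p ∪ q ∣ + ∣ p ∩ q ∣) ≡⟨ cong suc (∣p∪q∣+∣p∩q∣≡∣p∣+∣q∣ p q) ⟩
  suc (∣ p ∣ + ∣ q ∣)         ≡⟨ sym (+-suc ∣ p ∣ ∣ q ∣) ⟩
  ∣ p ∣ + suc ∣ q ∣           ∎)
  where open ≡-Reasoning

∣p∪q∣≤∣p∣+∣q∣ : ∀ {n} (p q : Subset n) → ∣ p ∪ q ∣ ≤ ∣ p ∣ + ∣ q ∣
∣p∪q∣≤∣p∣+∣q∣ p q = ≤-trans (m≤m+n ∣ p ∪ q ∣ ∣ p ∩ q ∣) (≤-reflexive (∣p∪q∣+∣p∩q∣≡∣p∣+∣q∣ p q))

Empty⇒∣p∣≡0 : ∀ {n} {p : Subset n} → Empty p → ∣ p ∣ ≡ 0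
Empty⇒∣p∣≡0 {n} e = trans (cong ∣_∣ (Empty-unique e)) (∣⊥∣≡0 n)

disjoint⇒∣p∪q∣≡∣p∣+∣q∣ : ∀ {n} (p q : Subset n) → Empty (p ∩ q) → ∣ p ∪ q ∣ ≡ ∣ p ∣ + ∣ q ∣
disjoint⇒∣p∪q∣≡∣p∣+∣q∣ p q e = begin
  ∣ p ∪ q ∣                ≡⟨ sym (+-identityʳ ∣ p ∪ q ∣) ⟩
  ∣ p ∪ q ∣ + 0            ≡⟨ cong (∣ p ∪ q ∣ +_) (sym (Empty⇒∣p∣≡0 e)) ⟩
  ∣ p ∪ q ∣ + ∣ p ∩ q ∣    ≡⟨ ∣p∪q∣+∣p∩q∣≡∣p∣+∣q∣ p q ⟩
  ∣ p ∣ + ∣ q ∣            ∎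
  where open ≡-Reasoning

0<∣p∣⇒Nonempty : ∀ {n} {p : Subset n} → 0 < ∣ p ∣ → Nonempty p
0<∣p∣⇒Nonempty {p = p} pos with nonempty? p
... | yes ne = ne
... | no e   = contradiction (Empty⇒∣p∣≡0 e) λ eq → <⇒≱ pos (≤-reflexive eq)

x∈p⇒0<∣p∣ : ∀ {n} {x : Fin n} {p : Subset n} → x ∈ p → 0 < ∣ p ∣
x∈p⇒0<∣p∣ x∈p = ≤-<-trans z≤n (x∈p⇒∣p-x∣<∣p∣ x∈p)

x∈p─q⇒x∉q : ∀ {n} {x : Fin n} (p q : Subset n) → x ∈ p ─ q → x ∉ q
x∈p─q⇒x∉q (_ ∷ p) (inside ∷ q)  (there x∈) (there x∈q) = x∈p─q⇒x∉q p q x∈ x∈q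
x∈p─q⇒x∉q (_ ∷ p) (outside ∷ q) (there x∈) (there x∈q) = x∈p─q⇒x∉q p q x∈ x∈q

module Hall {m k : ℕ} {_~_ : Fin m → Fin k → Set} (_~?_ : Decidable _~_) where

  adjacent? : (X : Subset m) (j : Fin k) → Dec (∃ λ p → p ∈ X × p ~ j)
  adjacent? X j = any? λ p → (p ∈? X) ×-dec (p ~? j)

  N : Subset m → Subset k
  N X = tabulate λ j → does (adjacent? X j)

  N-intro : ∀ {X p j} → p ∈ X → p ~ j → j ∈ N X
  N-intro {X} {p} {j} p∈X p~j = lookup⇒[]= j (N X)
    (trans (lookup∘tabulate (λ j → does (adjacent? X j)) j) (dec-true (adjacent? X j) (p , p∈X , p~j)))

  N-elim : ∀ {X j} → j ∈ N X → ∃ λ p → p ∈ X × p ~ j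
  N-elim {X} {j} j∈N =
    witness (adjacent? X j) (trans (sym (lookup∘tabulate (λ j → does (adjacent? X j)) j)) ([]=⇒lookup j∈N))
    where
    witness : ∀ {P : Set} (P? : Dec P) → does P? ≡ true → P
    witness (yes p) _ = p

  record Matching (A : Subset m) (B : Subset k) : Set where
    field
      match     : ∀ {p} → p ∈ A → Fin k
      into      : ∀ {p} (p∈A : p ∈ A) → match p∈A ∈ B
      adjacent  : ∀ {p} (p∈A : p ∈ A) → p ~ match p∈A
      injective : ∀ {p q} (p∈A : p ∈ A) (q∈A : q ∈ A) → match p∈A ≡ match q∈A → p ≡ q

  HallCondition : Subset m → Subset k → Set
  HallCondition A B = ∀ X → X ⊆ A → ∣ X ∣ ≤ ∣ N X ∩ B ∣

  emptyMatching : ∀ {A B} → Empty A → Matching A B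
  emptyMatching {A} empty = record
    { match = λ p∈A → absurd p∈A ; into = λ p∈A → absurd p∈A
    ; adjacent = λ p∈A → absurd p∈A ; injective = λ p∈A _ _ → absurd p∈A }
    where
    absurd : ∀ {p} {P : Set} → p ∈ A → P
    absurd {p} p∈A = ⊥-elim (empty (p , p∈A))

  singleMatching : ∀ {p₀ j₀} → p₀ ~ j₀ → Matching ⁅ p₀ ⁆ ⁅ j₀ ⁆
  singleMatching {p₀} {j₀} p₀~j₀ = record
    { match     = λ _ → j₀
    ; into      = λ _ → x∈⁅x⁆ j₀
    ; adjacent  = λ p∈ → subst (_~ j₀) (sym (x∈⁅y⁆⇒x≡y p₀ p∈)) p₀~j₀
    ; injective = λ p∈ q∈ _ → trans (x∈⁅y⁆⇒x≡y p₀ p∈) (sym (x∈⁅y⁆⇒x≡y p₀ q∈)) }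

  matchIntoN : ∀ {X B} → Matching X B → Matching X (N X ∩ B)
  matchIntoN M = record
    { match     = match
    ; into      = λ p∈X → x∈p∩q⁺ (N-intro p∈X (adjacent p∈X) , into p∈X)
    ; adjacent  = adjacent
    ; injective = injective }
    where open Matching M

  glue : ∀ {A X B B₁ B₂} → B₁ ⊆ B → B₂ ⊆ B → (∀ {j} → j ∈ B₁ → j ∉ B₂) →
         Matching X B₁ → Matching (A ─ X) B₂ → Matching A B
  glue {A} {X} {B} {B₁} {B₂} B₁⊆B B₂⊆B disjoint M₁ M₂ = record
    { match = match ; into = into ; adjacent = adjacent ; injective = injective }
    where
    module M₁ = Matching M₁
    module M₂ = Matching M₂

    rest : ∀ {p} → p ∈ A → p ∉ X → p ∈ A ─ X
    rest = x∈p∧x∉q⇒x∈p─q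

    match : ∀ {p} → p ∈ A → Fin k
    match {p} p∈A with p ∈? X
    ... | yes p∈X = M₁.match p∈X
    ... | no  p∉X = M₂.match (rest p∈A p∉X)

    into : ∀ {p} (p∈A : p ∈ A) → match p∈A ∈ B
    into {p} p∈A with p ∈? X
    ... | yes p∈X = B₁⊆B (M₁.into p∈X)
    ... | no  p∉X = B₂⊆B (M₂.into (rest p∈A p∉X))

    adjacent : ∀ {p} (p∈A : p ∈ A) → p ~ match p∈A
    adjacent {p} p∈A with p ∈? X
    ... | yes p∈X = M₁.adjacent p∈X
    ... | no  p∉X = M₂.adjacent (rest p∈A p∉X)

    crossing : ∀ {p q} (p∈X : p ∈ X) (q∈ : q ∈ A ─ X) → M₁.match p∈X ≢ M₂.match q∈
    crossing p∈X q∈ eq = disjoint (M₁.into p∈X) (subst (_∈ B₂) (sym eq) (M₂.into q∈))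

    injective : ∀ {p q} (p∈A : p ∈ A) (q∈A : q ∈ A) → match p∈A ≡ match q∈A → p ≡ q
    injective {p} {q} p∈A q∈A eq with p ∈? X | q ∈? X
    ... | yes p∈X | yes q∈X = M₁.injective p∈X q∈X eq
    ... | no  p∉X | no  q∉X = M₂.injective (rest p∈A p∉X) (rest q∈A q∉X) eq
    ... | yes p∈X | no  q∉X = contradiction eq (crossing p∈X (rest q∈A q∉X))
    ... | no  p∉X | yes q∈X = contradiction (sym eq) (crossing q∈X (rest p∈A p∉X))

  Critical : Subset m → Subset k → Subset m → Set
  Critical A B X = X ⊆ A × Nonempty X × ∣ X ∣ < ∣ A ∣ × ∣ N X ∩ B ∣ ≤ ∣ X ∣

  critical? : ∀ A B X → Dec (Critical A B X)
  critical? A B X = (X ⊆? A) ×-dec nonempty? X ×-dec (∣ X ∣ <? ∣ A ∣) ×-dec (∣ N X ∩ B ∣ ≤? ∣ X ∣)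

  N-∪-split : ∀ X Y B → N (X ∪ Y) ∩ B ⊆ (N X ∩ B) ∪ (N Y ∩ (B ─ N X))
  N-∪-split X Y B {j} j∈ with x∈p∩q⁻ (N (X ∪ Y)) B j∈ | j ∈? N X
  ... | _          , j∈B | yes j∈NX = x∈p∪q⁺ (inj₁ (x∈p∩q⁺ (j∈NX , j∈B)))
  ... | j∈N[X∪Y] , j∈B | no  j∉NX with N-elim j∈N[X∪Y]
  ...   | p , p∈X∪Y , p~j with x∈p∪q⁻ X Y p∈X∪Y
  ...     | inj₁ p∈X = contradiction (N-intro p∈X p~j) j∉NX
  ...     | inj₂ p∈Y = x∈p∪q⁺ (inj₂ (x∈p∩q⁺ (N-intro p∈Y p~j , x∈p∧x∉q⇒x∈p─q j∈B j∉NX)))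

  hallAfterCritical : ∀ {A B X} → HallCondition A B → X ⊆ A → ∣ N X ∩ B ∣ ≤ ∣ X ∣ →
                      HallCondition (A ─ X) (B ─ N X)
  hallAfterCritical {A} {B} {X} hall X⊆A tight Y Y⊆ = +-cancelˡ-≤ (∣ X ∣) (∣ Y ∣) (∣ N Y ∩ B' ∣) (begin
    ∣ X ∣ + ∣ Y ∣                      ≡⟨ sym (disjoint⇒∣p∪q∣≡∣p∣+∣q∣ X Y X∩Y-empty) ⟩
    ∣ X ∪ Y ∣                          ≤⟨ hall (X ∪ Y) X∪Y⊆A ⟩
    ∣ N (X ∪ Y) ∩ B ∣                  ≤⟨ p⊆q⇒∣p∣≤∣q∣ (N-∪-split X Y B) ⟩
    ∣ (N X ∩ B) ∪ (N Y ∩ B') ∣         ≤⟨ ∣p∪q∣≤∣p∣+∣q∣ (N X ∩ B) (N Y ∩ B') ⟩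
    ∣ N X ∩ B ∣ + ∣ N Y ∩ B' ∣         ≤⟨ +-monoˡ-≤ ∣ N Y ∩ B' ∣ tight ⟩
    ∣ X ∣ + ∣ N Y ∩ B' ∣               ∎)
    where
    open ≤-Reasoning
    B' = B ─ N X
    X∩Y-empty : Empty (X ∩ Y)
    X∩Y-empty (z , z∈X∩Y) = let (z∈X , z∈Y) = x∈p∩q⁻ X Y z∈X∩Y in x∈p─q⇒x∉q A X (Y⊆ z∈Y) z∈X
    X∪Y⊆A : X ∪ Y ⊆ A
    X∪Y⊆A z∈ with x∈p∪q⁻ X Y z∈
    ... | inj₁ z∈X = X⊆A z∈X
    ... | inj₂ z∈Y = p─q⊆p A X (Y⊆ z∈Y)

  hallWithoutCritical : ∀ {A B p₀} j₀ → p₀ ∈ A → (∀ X → ¬ Critical A B X) →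
                        HallCondition (A - p₀) (B - j₀)
  hallWithoutCritical {A} {B} {p₀} j₀ p₀∈A noCritical Y Y⊆ with nonempty? Y
  ... | no  empty = ≤-trans (≤-reflexive (Empty⇒∣p∣≡0 empty)) z≤n
  ... | yes nonempty = ≤-pred (begin-strict
    ∣ Y ∣                              <⟨ ≰⇒> (λ le → noCritical Y (Y⊆A , nonempty , Y<A , le)) ⟩
    ∣ N Y ∩ B ∣                        ≤⟨ p⊆q⇒∣p∣≤∣q∣ split ⟩
    ∣ (N Y ∩ (B - j₀)) ∪ ⁅ j₀ ⁆ ∣      ≤⟨ ∣p∪q∣≤∣p∣+∣q∣ (N Y ∩ (B - j₀)) ⁅ j₀ ⁆ ⟩
    ∣ N Y ∩ (B - j₀) ∣ + ∣ ⁅ j₀ ⁆ ∣    ≡⟨ cong (∣ N Y ∩ (B - j₀) ∣ +_) (∣⁅x⁆∣≡1 j₀) ⟩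
    ∣ N Y ∩ (B - j₀) ∣ + 1             ≡⟨ +-comm ∣ N Y ∩ (B - j₀) ∣ 1 ⟩
    suc ∣ N Y ∩ (B - j₀) ∣             ∎)
    where
    open ≤-Reasoning
    Y⊆A : Y ⊆ A
    Y⊆A y∈Y = p─q⊆p A ⁅ p₀ ⁆ (Y⊆ y∈Y)
    Y<A : ∣ Y ∣ < ∣ A ∣
    Y<A = ≤-<-trans (p⊆q⇒∣p∣≤∣q∣ Y⊆) (x∈p⇒∣p-x∣<∣p∣ p₀∈A)
    split : N Y ∩ B ⊆ (N Y ∩ (B - j₀)) ∪ ⁅ j₀ ⁆
    split {j} j∈ with j ≟ j₀
    ... | yes refl = x∈p∪q⁺ (inj₂ (x∈⁅x⁆ j₀))
    ... | no  j≢j₀ = let (j∈N , j∈B) = x∈p∩q⁻ (N Y) B j∈ in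
                     x∈p∪q⁺ (inj₁ (x∈p∩q⁺ (j∈N , x∈p∧x≢y⇒x∈p-y j∈B j≢j₀)))

  neighbourIn : ∀ {A B p} → HallCondition A B → p ∈ A → ∃ λ j → j ∈ B × p ~ j
  neighbourIn {A} {B} {p} hall p∈A with 0<∣p∣⇒Nonempty (≤-trans (≤-reflexive (sym (∣⁅x⁆∣≡1 p))) (hall ⁅ p ⁆ ⁅p⁆⊆A))
    where
    ⁅p⁆⊆A : ⁅ p ⁆ ⊆ A
    ⁅p⁆⊆A q∈ = subst (_∈ A) (sym (x∈⁅y⁆⇒x≡y p q∈)) p∈A
  ... | j , j∈ with x∈p∩q⁻ (N ⁅ p ⁆) B j∈
  ...   | j∈N , j∈B with N-elim j∈N
  ...     | q , q∈⁅p⁆ , q~j = j , j∈B , subst (_~ j) (x∈⁅y⁆⇒x≡y p q∈⁅p⁆) q~j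

  -- Hall's theorem relative to A and B, by induction on a bound for ∣ A ∣: either split A
  -- along a critical set, or match one vertex to any neighbour and recurse.
  hall : ∀ n A B → ∣ A ∣ ≤ n → HallCondition A B → Matching A B
  hall zero A B size _ = emptyMatching λ (p , p∈A) → <⇒≱ (x∈p⇒0<∣p∣ p∈A) size
  hall (suc n) A B size hallAB with anySubset? (critical? A B)
  ... | yes (X , X⊆A , (x , x∈X) , X<A , tight) =
    glue (p∩q⊆q (N X) B) (p─q⊆p B (N X))
         (λ j∈N[X]∩B j∈B─N[X] → x∈p─q⇒x∉q B (N X) j∈B─N[X] (proj₁ (x∈p∩q⁻ (N X) B j∈N[X]∩B)))
         (matchIntoN (hall n X B (≤-pred (≤-trans X<A size)) λ Y Y⊆X → hallAB Y (⊆-trans Y⊆X X⊆A)))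
         (hall n (A ─ X) (B ─ N X) (≤-pred (≤-trans A─X<A size)) (hallAfterCritical hallAB X⊆A tight))
    where
    A─X<A : ∣ A ─ X ∣ < ∣ A ∣
    A─X<A = p∩q≢∅⇒∣p─q∣<∣p∣ A X (x , x∈p∩q⁺ (X⊆A x∈X , x∈X))
  ... | no noCritical with nonempty? A
  ...   | no  empty = emptyMatching empty
  ...   | yes (p₀ , p₀∈A) with neighbourIn hallAB p₀∈A
  ...     | j₀ , j₀∈B , p₀~j₀ =
    glue (λ j∈⁅j₀⁆ → subst (_∈ B) (sym (x∈⁅y⁆⇒x≡y j₀ j∈⁅j₀⁆)) j₀∈B) (p─q⊆p B ⁅ j₀ ⁆)
         (λ j∈⁅j₀⁆ j∈B-j₀ → x∈p─q⇒x∉q B ⁅ j₀ ⁆ j∈B-j₀ j∈⁅j₀⁆)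
         (singleMatching p₀~j₀)
         (hall n (A - p₀) (B - j₀) (≤-pred (≤-trans (x∈p⇒∣p-x∣<∣p∣ p₀∈A) size))
               (hallWithoutCritical j₀ p₀∈A λ X → noCritical ∘ (X ,_)))

  hallTheorem : (∀ X → ∣ X ∣ ≤ ∣ N X ∣) →
                Σ (Fin m → Fin k) λ φ → Injective _≡_ _≡_ φ × (∀ p → p ~ φ p)
  hallTheorem hallN = (λ p → match (∈⊤ {x = p})) , (λ eq → injective ∈⊤ ∈⊤ eq) , (λ p → adjacent ∈⊤)
    where
    open Matching (hall m ⊤ ⊤ (≤-reflexive (∣⊤∣≡n m))
                        λ X _ → subst (∣ X ∣ ≤_) (cong ∣_∣ (sym (∩-identityʳ (N X)))) (hallN X))

sumOver : ∀ {n} → Subset n → (Fin n → ℕ) → ℕ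
sumOver []            f = 0
sumOver (inside ∷ X)  f = f zero + sumOver X (f ∘ suc)
sumOver (outside ∷ X) f = sumOver X (f ∘ suc)

sumOver-lower : ∀ {n} (X : Subset n) {f : Fin n → ℕ} c → (∀ {p} → p ∈ X → c ≤ f p) → ∣ X ∣ * c ≤ sumOver X f
sumOver-lower []            c bound = z≤n
sumOver-lower (inside ∷ X)  c bound = +-mono-≤ (bound here) (sumOver-lower X c (bound ∘ there))
sumOver-lower (outside ∷ X) c bound = sumOver-lower X c (bound ∘ there)

sumOver-upper : ∀ {n} (X : Subset n) {f : Fin n → ℕ} c → (∀ {p} → p ∈ X → f p ≤ c) → sumOver X f ≤ ∣ X ∣ * c
sumOver-upper []            c bound = z≤n
sumOver-upper (inside ∷ X)  c bound = +-mono-≤ (bound here) (sumOver-upper X c (bound ∘ there))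
sumOver-upper (outside ∷ X) c bound = sumOver-upper X c (bound ∘ there)

sumOver-zero : ∀ {n} (X : Subset n) {f : Fin n → ℕ} → (∀ {p} → p ∈ X → f p ≡ 0) → sumOver X f ≡ 0
sumOver-zero []            vanish = refl
sumOver-zero (inside ∷ X)  vanish = cong₂ _+_ (vanish here) (sumOver-zero X (vanish ∘ there))
sumOver-zero (outside ∷ X) vanish = sumOver-zero X (vanish ∘ there)

sumOver-≥ : ∀ {n} (X : Subset n) {f : Fin n → ℕ} {p} → p ∈ X → f p ≤ sumOver X f
sumOver-≥ (inside ∷ X)  here        = m≤m+n _ _
sumOver-≥ (inside ∷ X)  (there p∈X) = ≤-trans (sumOver-≥ X p∈X) (m≤n+m _ _)
sumOver-≥ (outside ∷ X) (there p∈X) = sumOver-≥ X p∈X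

sumOver-single : ∀ {n} (X : Subset n) {f : Fin n → ℕ} p → (∀ {q} → q ∈ X → q ≢ p → f q ≡ 0) → sumOver X f ≤ f p
sumOver-single []            p       vanish = z≤n
sumOver-single (inside ∷ X) {f} zero vanish =
  ≤-reflexive (trans (cong (f zero +_) (sumOver-zero X λ q∈X → vanish (there q∈X) λ ())) (+-identityʳ _))
sumOver-single (outside ∷ X) zero    vanish = ≤-trans (≤-reflexive (sumOver-zero X λ q∈X → vanish (there q∈X) λ ())) z≤n
sumOver-single (inside ∷ X) {f} (suc p) vanish =
  ≤-trans (≤-reflexive (cong (_+ sumOver X (f ∘ suc)) (vanish here λ ()))) (sumOver-single X p λ q∈X q≢p → vanish (there q∈X) (q≢p ∘ Fin-suc-injective))
sumOver-single (outside ∷ X) (suc p) vanish = sumOver-single X p λ q∈X q≢p → vanish (there q∈X) (q≢p ∘ Fin-suc-injective)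

module _ {A : Set} where

  sum-map-+ : (f g : A → ℕ) (xs : List A) → sum (map (λ x → f x + g x) xs) ≡ sum (map f xs) + sum (map g xs)
  sum-map-+ f g []       = refl
  sum-map-+ f g (x ∷ xs) = trans (cong (f x + g x +_) (sum-map-+ f g xs))
                                 (interchange (f x) (g x) (sum (map f xs)) (sum (map g xs)))

  sum-map-zero : (xs : List A) → sum (map (λ _ → 0) xs) ≡ 0
  sum-map-zero []       = refl
  sum-map-zero (x ∷ xs) = sum-map-zero xs

  sum-map-mono : {f g : A → ℕ} → (∀ x → f x ≤ g x) → (xs : List A) → sum (map f xs) ≤ sum (map g xs)
  sum-map-mono f≤g []       = z≤n
  sum-map-mono f≤g (x ∷ xs) = +-mono-≤ (f≤g x) (sum-map-mono f≤g xs)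

  sumOver-sum-comm : ∀ {n} (X : Subset n) (g : Fin n → A → ℕ) (xs : List A) →
                     sumOver X (λ p → sum (map (g p) xs)) ≡ sum (map (λ x → sumOver X (λ p → g p x)) xs)
  sumOver-sum-comm []            g xs = sym (sum-map-zero xs)
  sumOver-sum-comm (inside ∷ X)  g xs =
    trans (cong (sum (map (g zero) xs) +_) (sumOver-sum-comm X (g ∘ suc) xs))
          (sym (sum-map-+ (g zero) (λ x → sumOver X (λ p → g (suc p) x)) xs))
  sumOver-sum-comm (outside ∷ X) g xs = sumOver-sum-comm X (g ∘ suc) xs

capacityCount : ∀ {m k} (X : Subset m) (Y : Subset k) (c : ℕ) {w : Fin m → ℕ} {u : Fin k → ℕ} →
                (∀ {p} → p ∈ X → c < w p) → (∀ {j} → j ∈ Y → u j ≤ c) →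
                sumOver X w ≤ sumOver Y u → ∣ X ∣ ≤ ∣ Y ∣
capacityCount X Y c heavy light X≤Y = *-cancelʳ-≤ ∣ X ∣ ∣ Y ∣ (suc c) (begin
  ∣ X ∣ * suc c  ≤⟨ sumOver-lower X (suc c) heavy ⟩
  sumOver X _    ≤⟨ X≤Y ⟩
  sumOver Y _    ≤⟨ sumOver-upper Y c light ⟩
  ∣ Y ∣ * c      ≤⟨ *-monoʳ-≤ ∣ Y ∣ (n≤1+n c) ⟩
  ∣ Y ∣ * suc c  ∎)
  where open ≤-Reasoning

indicator : Bool → ℕ → ℕ
indicator b c = if b then c else 0

indicatorTransfer : ∀ {m k} (X : Subset m) (Y : Subset k) (F : Fin m → Bool) (H : Fin k → Bool) (c : ℕ) →
                    (∀ {p q} → F p ≡ true → F q ≡ true → p ≡ q) →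
                    (∀ {p} → p ∈ X → F p ≡ true → ∃ λ j → j ∈ Y × H j ≡ true) →
                    sumOver X (λ p → indicator (F p) c) ≤ sumOver Y (λ j → indicator (H j) c)
indicatorTransfer X Y F H c unique covered with any? (λ p → (p ∈? X) ×-dec (F p Bool.≟ true))
... | no none = ≤-trans (≤-reflexive (sumOver-zero X vanish)) z≤n
  where
  vanish : ∀ {p} → p ∈ X → indicator (F p) c ≡ 0
  vanish {p} p∈X with F p in Fp
  ... | true  = contradiction (p , p∈X , Fp) none
  ... | false = refl
... | yes (p , p∈X , Fp) with covered p∈X Fp
...   | j , j∈Y , Hj = begin
  sumOver X (λ q → indicator (F q) c)  ≤⟨ sumOver-single X p vanish ⟩
  indicator (F p) c                     ≡⟨ cong (λ b → indicator b c) (trans Fp (sym Hj)) ⟩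
  indicator (H j) c                     ≤⟨ sumOver-≥ Y j∈Y ⟩
  sumOver Y (λ j → indicator (H j) c)  ∎
  where
  open ≤-Reasoning
  vanish : ∀ {q} → q ∈ X → q ≢ p → indicator (F q) c ≡ 0
  vanish {q} _ q≢p with F q in Fq
  ... | true  = contradiction (unique Fq Fp) q≢p
  ... | false = refl

module _ {L : Set} (d : L → ℕ) where

  weight : (L → Bool) → List L → ℕ
  weight S xs = sum (map (λ l → indicator (S l) (d l)) xs)

  weight-∨ : ∀ {S T : L → Bool} → (∀ {l} → S l ≡ true → T l ≡ false) → (xs : List L) →
             weight (λ l → S l ∨ T l) xs ≡ weight S xs + weight T xs
  weight-∨ {S} {T} disjoint xs =
    trans (cong sum (map-cong split xs)) (sum-map-+ (λ l → indicator (S l) (d l)) (λ l → indicator (T l) (d l)) xs)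
    where
    split : ∀ l → indicator (S l ∨ T l) (d l) ≡ indicator (S l) (d l) + indicator (T l) (d l)
    split l with S l in Sl
    ... | true  rewrite disjoint Sl = sym (+-identityʳ (d l))
    ... | false = refl

  weight-∈ : ∀ {S : L → Bool} {l} {xs : List L} → l ∈ˡ xs → S l ≡ true → d l ≤ weight S xs
  weight-∈ {S} {l} (here refl) Sl = ≤-trans (≤-reflexive (cong (λ b → indicator b (d l)) (sym Sl))) (m≤m+n _ _)
  weight-∈ (there l∈xs) Sl = ≤-trans (weight-∈ l∈xs Sl) (m≤n+m _ _)

  weightTransfer : ∀ {m k} (X : Subset m) (Y : Subset k) (F : Fin m → L → Bool) (H : Fin k → L → Bool) →
                   (∀ {p q l} → F p l ≡ true → F q l ≡ true → p ≡ q) →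
                   (∀ {p l} → p ∈ X → F p l ≡ true → ∃ λ j → j ∈ Y × H j l ≡ true) →
                   (xs : List L) → sumOver X (λ p → weight (F p) xs) ≤ sumOver Y (λ j → weight (H j) xs)
  weightTransfer X Y F H unique covered xs = begin
    sumOver X (λ p → weight (F p) xs)                          ≡⟨ sumOver-sum-comm X (λ p l → indicator (F p l) (d l)) xs ⟩
    sum (map (λ l → sumOver X (λ p → indicator (F p l) (d l))) xs)
      ≤⟨ sum-map-mono (λ l → indicatorTransfer X Y (λ p → F p l) (λ j → H j l) (d l) unique covered) xs ⟩
    sum (map (λ l → sumOver Y (λ j → indicator (H j l) (d l))) xs) ≡⟨ sumOver-sum-comm Y (λ j l → indicator (H j l) (d l)) xs ⟨
    sumOver Y (λ j → weight (H j) xs)                          ∎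
    where open ≤-Reasoning

InPair : ℕ → ℕ → Set
InPair p i = i ≡ 2 * p ⊎ i ≡ suc (2 * p)

inPair-unique : ∀ {p q i} → InPair p i → InPair q i → p ≡ q
inPair-unique {p} {q} (inj₁ i≡2p)  (inj₁ i≡2q)  = *-cancelˡ-≡ p q 2 (trans (sym i≡2p) i≡2q)
inPair-unique {p} {q} (inj₂ i≡2p+1) (inj₂ i≡2q+1) = *-cancelˡ-≡ p q 2 (suc-injective (trans (sym i≡2p+1) i≡2q+1))
inPair-unique {p} {q} (inj₁ i≡2p)  (inj₂ i≡2q+1) = contradiction (trans (sym i≡2p) i≡2q+1) (even≢odd p q)
inPair-unique {p} {q} (inj₂ i≡2p+1) (inj₁ i≡2q)  = contradiction (trans (sym i≡2q) i≡2p+1) (even≢odd q p)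

pair-bound : ∀ n (p : Fin (n / 2)) → suc (2 * toℕ p) < n
pair-bound n p = begin-strict
  suc (2 * toℕ p)   <⟨ n<1+n _ ⟩
  2 + 2 * toℕ p     ≡⟨ *-suc 2 (toℕ p) ⟨
  2 * suc (toℕ p)   ≤⟨ *-monoʳ-≤ 2 (toℕ<n p) ⟩
  2 * (n / 2)       ≡⟨ *-comm 2 (n / 2) ⟩
  n / 2 * 2         ≤⟨ m/n*n≤m n 2 ⟩
  n                 ∎
  where open ≤-Reasoning

∈-allLinks : ∀ G (l : Link G) → l ∈ˡ allLinks G
∈-allLinks G (inj₁ e) = ∈-++⁺ˡ (∈-map⁺ inj₁ (∈-allFin e))
∈-allLinks G (inj₂ a) = ∈-++⁺ʳ _ (∈-map⁺ inj₂ (∈-allFin a))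

begins⇒firstServed : ∀ G (S : Defs.Subset G) w → BeginsIn G S w →
                     ∃ λ a → firstServed G S w ≡ just a × S a ≡ true
begins⇒firstServed G S (x ∷ w) Sx rewrite Sx = linkOf G x , refl , Sx

module Pairing {I : Instance} {T : Walk (Instance.G I)} {S : Splitting I} (feasible : FeasibleSplitting I T S) where
  open Instance I
  open Splitting S
  open FeasibleSplitting feasible

  Pair : Set
  Pair = Fin (ℓ / 2)

  first second : Pair → Fin ℓ
  first p  = fromℕ< (<-trans (n<1+n _) (pair-bound ℓ p))
  second p = fromℕ< (pair-bound ℓ p)

  toℕ-first : ∀ p → toℕ (first p) ≡ 2 * toℕ p
  toℕ-first p = toℕ-fromℕ< _

  toℕ-second : ∀ p → toℕ (second p) ≡ suc (2 * toℕ p)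
  toℕ-second p = toℕ-fromℕ< _

  first-at : ∀ p {i} → toℕ i ≡ 2 * toℕ p → i ≡ first p
  first-at p i≡2p = toℕ-injective (trans i≡2p (sym (toℕ-first p)))

  second-at : ∀ p {j} → toℕ j ≡ suc (2 * toℕ p) → j ≡ second p
  second-at p j≡2p+1 = toℕ-injective (trans j≡2p+1 (sym (toℕ-second p)))

  pairServe : Pair → Link G → Bool
  pairServe p l = serve (first p) l ∨ serve (second p) l

  servedByOne : ∀ {i j l} → serve i l ≡ true → serve j l ≡ true → i ≡ j
  servedByOne {i} {j} {l} il jl with partition l (servesReq i l il)
  ... | _ , _ , only = trans (only i il) (sym (only j jl))

  pairServe-index : ∀ {p l} → pairServe p l ≡ true → ∃ λ i → serve i l ≡ true × InPair (toℕ p) (toℕ i)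
  pairServe-index {p} {l} pl with serve (first p) l in firstl
  ... | true  = first p , firstl , inj₁ (toℕ-first p)
  ... | false = second p , pl , inj₂ (toℕ-second p)

  pairServe-disjoint : ∀ {p q l} → pairServe p l ≡ true → pairServe q l ≡ true → p ≡ q
  pairServe-disjoint {p} {q} pl ql with pairServe-index {p} pl | pairServe-index {q} ql
  ... | i , il , i∈p | j , jl , j∈q with servedByOne il jl
  ...   | refl = toℕ-injective (inPair-unique i∈p j∈q)

  pairDemand : ∀ p → Q < load G d (pairServe p)
  pairDemand p with begins⇒firstServed G (serve (second p)) (seg (second p)) (begins (second p))
  ... | a , firstServed≡a , second-a = begin-strict
    Q                                                          <⟨ maximal (first p) (second p) a consecutive firstServed≡a ⟩
    load G d (serve (first p)) + d a                           ≤⟨ +-monoʳ-≤ _ (weight-∈ d (∈-allLinks G a) second-a) ⟩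
    load G d (serve (first p)) + load G d (serve (second p))   ≡⟨ weight-∨ d disjoint (allLinks G) ⟨
    load G d (pairServe p)                                     ∎
    where
    open ≤-Reasoning
    consecutive : toℕ (second p) ≡ suc (toℕ (first p))
    consecutive = trans (toℕ-second p) (cong suc (sym (toℕ-first p)))
    disjoint : ∀ {l} → serve (first p) l ≡ true → serve (second p) l ≡ false
    disjoint {l} firstl with serve (second p) l in secondl
    ... | true  = contradiction (cong toℕ (servedByOne firstl secondl)) λ eq → 1+n≢n (trans (sym consecutive) (sym eq))
    ... | false = refl

  module AgainstSolution {W* : Solution I} (feasible* : Feasible I W*) where
    serve* : Fin (Solution.k W*) → Link G → Bool
    serve* = Solution.serve W*

    Shares : Pair → Fin (Solution.k W*) → Set
    Shares p j = Any (λ l → pairServe p l ≡ true × serve* j l ≡ true) (allLinks G)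

    shares? : ∀ p j → Dec (Shares p j)
    shares? p j = Any.any? (λ l → (pairServe p l Bool.≟ true) ×-dec (serve* j l Bool.≟ true)) (allLinks G)

    open Hall shares? using (N; N-intro; hallTheorem)

    -- Every set X of pairs serves more than ∣ X ∣·Q, all of it served by the walks in N X,
    -- which carry at most ∣ N X ∣·Q; hence ∣ X ∣ ≤ ∣ N X ∣.
    hallCondition : ∀ X → ∣ X ∣ ≤ ∣ N X ∣
    hallCondition X = capacityCount X (N X) Q (λ {p} _ → pairDemand p) (λ {j} _ → Feasible.capacity feasible* j)
                        (weightTransfer d X (N X) pairServe serve* pairServe-disjoint covered (allLinks G))
      where
      covered : ∀ {p l} → p ∈ X → pairServe p l ≡ true → ∃ λ j → j ∈ N X × serve* j l ≡ true
      covered {p} {l} p∈X pl with pairServe-index {p} pl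
      ... | i , il , _ with Feasible.servedOnce feasible* l (servesReq i l il)
      ...   | j , jl , _ = j , N-intro p∈X (lose (∈-allLinks G l) (pl , jl)) , jl

    pairsToWalks : Σ (Pair → Fin (Solution.k W*)) λ φ →
                   Injective _≡_ _≡_ φ × (∀ p → ∃ λ l → pairServe p l ≡ true × serve* (φ p) l ≡ true)
    pairsToWalks = proj₁ matching , proj₁ (proj₂ matching) , λ p → Any.satisfied (proj₂ (proj₂ matching) p)
      where
      matching : Σ (Pair → Fin (Solution.k W*)) λ φ → Injective _≡_ _≡_ φ × (∀ p → Shares p (φ p))
      matching = hallTheorem hallCondition

lemma5 : (I : Instance) (W* : Solution I) → Optimal I W* →
         (T : Walk (Instance.G I)) → IsClosedWalk (Instance.G I) T → ContainsRequired I T →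
         (S : Splitting I) → FeasibleSplitting I T S →
         Σ (Fin (Splitting.ℓ S / 2) → Fin (Solution.k W*)) λ φ →
           Injective _≡_ _≡_ φ ×
           (∀ p (i j : Fin (Splitting.ℓ S)) → toℕ i ≡ 2 * toℕ p → toℕ j ≡ suc (2 * toℕ p) →
             ∃ λ l → (Splitting.serve S i l ∨ Splitting.serve S j l) ≡ true ×
                     Solution.serve W* (φ p) l ≡ true)
lemma5 I W* optimal T _ _ S feasible = φ , φ-injective , common
  where
  open Pairing feasible
  open AgainstSolution (proj₁ optimal) using (serve*; pairsToWalks)
  φ : Pair → Fin (Solution.k W*)
  φ = proj₁ pairsToWalks
  φ-injective : Injective _≡_ _≡_ φ
  φ-injective = proj₁ (proj₂ pairsToWalks)
  SharesWith : Pair → Fin (Splitting.ℓ S) → Fin (Splitting.ℓ S) → Set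
  SharesWith p i j = ∃ λ l → (Splitting.serve S i l ∨ Splitting.serve S j l) ≡ true × serve* (φ p) l ≡ true
  common : ∀ p i j → toℕ i ≡ 2 * toℕ p → toℕ j ≡ suc (2 * toℕ p) → SharesWith p i j
  common p i j i≡2p j≡2p+1 =
    subst₂ (SharesWith p) (sym (first-at p i≡2p)) (sym (second-at p j≡2p+1)) (proj₂ (proj₂ pairsToWalks) p)
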